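{- Let $\Gamma$ be a context of full intuitionistic propositional logic, let $(x:\psi)\in\Gamma$, let $\alpha$ be an atom or a disjunction, and let $T\in\mathrm{Trace}(\alpha,\psi)$. If $\Gamma\vdash\rho$ for all $\rho\in T$, then $\Gamma\vdash xE_1\ldots E_n:\alpha$ for some $n\geq 0$, where each of $E_1,\ldots,E_n$ is either a proof term or a projection $\pi_1,\pi_2$.
   Context: Formulas of full intuitionistic propositional logic (IPC) are built by $\varphi,\psi::=p\mid\bot\mid\varphi\to\psi\mid\varphi\land\psi\mid\varphi\lor\psi$ with $p$ a propositional variable; atoms are propositional variables and $\bot$. Proof terms are $M,N::=x\mid M[\varphi]\mid\lambda x{:}\varphi.M\mid MN\mid\langle M,N\rangle\mid M\pi_1\mid M\pi_2\mid \mathrm{in}_1M\mid\mathrm{in}_2M\mid M[x_1{:}\varphi.N_1;x_2{:}\psi.N_2]$. A context $\Gamma$ is a finite set of declarations $x:\varphi$ with distinct variables; $\Gamma\vdash M:\varphi$ is the standard natural-deduction typing (variable rule, $\to$-introduction by $\lambda$, $\to$-elimination by application, pairing and projections for $\land$, injections and case analysis for $\lor$, and $M[\varphi]:\varphi$ from $M:\bot$); $\Gamma\vdash\varphi$ means $\Gamma\vdash M:\varphi$ for some $M$. Application/elimination is left-associative, so $xE_1\ldots E_n$ means $(\ldots(xE_1)\ldots)E_n$, where $ME$ with $E=\pi_i$ denotes $M\pi_i$. Targets: $\mathrm{TG}(\mathbf a)=\{\mathbf a\}$ for an atom $\mathbf a$; $\mathrm{TG}(\tau\to\sigma)=\mathrm{TG}(\sigma)$;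 $\mathrm{TG}(\tau\lor\sigma)=\{\tau\lor\sigma\}$; $\mathrm{TG}(\tau\land\sigma)=\mathrm{TG}(\tau)\cup\mathrm{TG}(\sigma)$. Traces (each trace is a set of formulas): $\mathrm{Trace}(\alpha,\varphi)=\varnothing$ if $\alpha\notin\mathrm{TG}(\varphi)$; otherwise $\mathrm{Trace}(\alpha,\alpha)=\{\varnothing\}$; $\mathrm{Trace}(\alpha,\tau\to\sigma)=\{\{\tau\}\cup T\mid T\in\mathrm{Trace}(\alpha,\sigma)\}$; $\mathrm{Trace}(\alpha,\tau\land\sigma)=\mathrm{Trace}(\alpha,\tau)\cup\mathrm{Trace}(\alpha,\sigma)$. -}

module Defs where

open import Data.Nat using (ℕ)
import Data.Nat.Properties as ℕP
open import Data.List using (List; []; _∷_; _++_; map; [_])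
open import Data.List.Membership.Propositional using (_∈_; _∉_)
open import Data.List.Relation.Unary.Any using (any?)
open import Data.Product using (_×_; _,_; proj₁; ∃-syntax)
open import Relation.Nullary using (Dec; yes; no)
open import Relation.Binary.PropositionalEquality using (_≡_; refl; cong; cong₂)

infixr 25 _⇒_
infixr 30 _∧_ _∨_

data Form : Set where
  var : ℕ → Form
  ⊥'  : Form
  _⇒_ : Form → Form → Form
  _∧_ : Form → Form → Form
  _∨_ : Form → Form → Form

data IsAtom : Form → Set where
  atVar : ∀ p → IsAtom (var p)
  atBot : IsAtom ⊥'

data AtomOrDisj : Form → Set where
  atom : ∀ {a} → IsAtom a → AtomOrDisj a
  disj : ∀ τ σ → AtomOrDisj (τ ∨ σ)

_≟F_ : (φ ψ : Form) → Dec (φ ≡ ψ)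
var p ≟F var q with p ℕP.≟ q
... | yes refl = yes refl
... | no ne = no λ { refl → ne refl }
var _ ≟F ⊥' = no λ ()
var _ ≟F (_ ⇒ _) = no λ ()
var _ ≟F (_ ∧ _) = no λ ()
var _ ≟F (_ ∨ _) = no λ ()
⊥' ≟F var _ = no λ ()
⊥' ≟F ⊥' = yes refl
⊥' ≟F (_ ⇒ _) = no λ ()
⊥' ≟F (_ ∧ _) = no λ ()
⊥' ≟F (_ ∨ _) = no λ ()
(_ ⇒ _) ≟F var _ = no λ ()
(_ ⇒ _) ≟F ⊥' = no λ ()
(a ⇒ b) ≟F (c ⇒ d) with a ≟F c | b ≟F d
... | yes refl | yes refl = yes refl
... | no ne | _ = no λ { refl → ne refl }
... | yes _ | no ne = no λ { refl → ne refl }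
(_ ⇒ _) ≟F (_ ∧ _) = no λ ()
(_ ⇒ _) ≟F (_ ∨ _) = no λ ()
(_ ∧ _) ≟F var _ = no λ ()
(_ ∧ _) ≟F ⊥' = no λ ()
(_ ∧ _) ≟F (_ ⇒ _) = no λ ()
(a ∧ b) ≟F (c ∧ d) with a ≟F c | b ≟F d
... | yes refl | yes refl = yes refl
... | no ne | _ = no λ { refl → ne refl }
... | yes _ | no ne = no λ { refl → ne refl }
(_ ∧ _) ≟F (_ ∨ _) = no λ ()
(_ ∨ _) ≟F var _ = no λ ()
(_ ∨ _) ≟F ⊥' = no λ ()
(_ ∨ _) ≟F (_ ⇒ _) = no λ ()
(_ ∨ _) ≟F (_ ∧ _) = no λ ()
(a ∨ b) ≟F (c ∨ d) with a ≟F c | b ≟F d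
... | yes refl | yes refl = yes refl
... | no ne | _ = no λ { refl → ne refl }
... | yes _ | no ne = no λ { refl → ne refl }

-- Targets (a finite set, represented as a list)
TG : Form → List Form
TG (var p) = [ var p ]
TG ⊥' = [ ⊥' ]
TG (τ ⇒ σ) = TG σ
TG (τ ∨ σ) = [ τ ∨ σ ]
TG (τ ∧ σ) = TG τ ++ TG σ

-- Traces: Trace α φ is a set of traces (lists of formulas, read as sets)
mutual
  Trace : Form → Form → List (List Form)
  Trace α φ with any? (α ≟F_) (TG φ)
  ... | no _ = []
  ... | yes _ = Trace' α φ

  Trace' : Form → Form → List (List Form)
  Trace' α (τ ⇒ σ) = map (τ ∷_) (Trace α σ)
  Trace' α (τ ∧ σ) = Trace α τ ++ Trace α σ
  -- remaining cases: φ atom or disjunction, so TG φ = {φ} and α = φ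
  Trace' α (var p) = [ [] ]
  Trace' α ⊥' = [ [] ]
  Trace' α (τ ∨ σ) = [ [] ]

data Term : Set where
  v     : ℕ → Term
  abort : Term → Form → Term
  lam   : ℕ → Form → Term → Term
  app   : Term → Term → Term
  pair  : Term → Term → Term
  prj₁  : Term → Term
  prj₂  : Term → Term
  in₁   : Term → Term
  in₂   : Term → Term
  case  : Term → ℕ → Form → Term → ℕ → Form → Term → Term

-- Contexts: finite sets of declarations; distinctness of variables imposed separately
Ctx : Set
Ctx = List (ℕ × Form)

dom : Ctx → List ℕ
dom = map proj₁

infix 4 _⊢_∶_ _⊢_

data _⊢_∶_ (Γ : Ctx) : Term → Form → Set where
  ax    : ∀ {x φ} → (x , φ) ∈ Γ → Γ ⊢ v x ∶ φ
  ⊥E    : ∀ {M φ} → Γ ⊢ M ∶ ⊥' → Γ ⊢ abort M φ ∶ φ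
  ⇒I    : ∀ {x φ ψ M} → x ∉ dom Γ → ((x , φ) ∷ Γ) ⊢ M ∶ ψ → Γ ⊢ lam x φ M ∶ φ ⇒ ψ
  ⇒E    : ∀ {M N φ ψ} → Γ ⊢ M ∶ φ ⇒ ψ → Γ ⊢ N ∶ φ → Γ ⊢ app M N ∶ ψ
  ∧I    : ∀ {M N φ ψ} → Γ ⊢ M ∶ φ → Γ ⊢ N ∶ ψ → Γ ⊢ pair M N ∶ φ ∧ ψ
  ∧E₁   : ∀ {M φ ψ} → Γ ⊢ M ∶ φ ∧ ψ → Γ ⊢ prj₁ M ∶ φ
  ∧E₂   : ∀ {M φ ψ} → Γ ⊢ M ∶ φ ∧ ψ → Γ ⊢ prj₂ M ∶ ψ
  ∨I₁   : ∀ {M φ ψ} → Γ ⊢ M ∶ φ → Γ ⊢ in₁ M ∶ φ ∨ ψ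
  ∨I₂   : ∀ {M φ ψ} → Γ ⊢ M ∶ ψ → Γ ⊢ in₂ M ∶ φ ∨ ψ
  ∨E    : ∀ {M x₁ x₂ N₁ N₂ φ ψ ρ} → Γ ⊢ M ∶ φ ∨ ψ
        → x₁ ∉ dom Γ → ((x₁ , φ) ∷ Γ) ⊢ N₁ ∶ ρ
        → x₂ ∉ dom Γ → ((x₂ , ψ) ∷ Γ) ⊢ N₂ ∶ ρ
        → Γ ⊢ case M x₁ φ N₁ x₂ ψ N₂ ∶ ρ

_⊢_ : Ctx → Form → Set
Γ ⊢ φ = ∃[ M ] (Γ ⊢ M ∶ φ)

data Elim : Set where
  arg : Term → Elim
  π₁  : Elim
  π₂  : Elim

_·E_ : Term → Elim → Term
M ·E arg N = app M N
M ·E π₁ = prj₁ M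
M ·E π₂ = prj₂ M

_·_ : Term → List Elim → Term
M · [] = M
M · (E ∷ Es) = (M ·E E) · Es

-- A trace T ∈ Trace(α, ψ) records a path through ψ to the target α: at an
-- implication τ ⇒ σ it contributes τ and continues in σ, at a conjunction it
-- chooses a conjunct. Following that path from any proof M of ψ, applying M to
-- proofs of the recorded premises and projecting at conjunctions, yields a
-- proof of α of the form M E₁ … Eₙ.
module Submission where

open import Defs
open import Data.Nat using (ℕ)
open import Data.List using (List; []; _∷_; [_]; map)
open import Data.List.Membership.Propositional using (_∈_)
open import Data.List.Membership.Propositional.Properties using (∈-++⁻; ∈-map⁻)
open import Data.List.Relation.Unary.Any using (here; there; any?)
open import Data.List.Relation.Unary.Any.Properties using (singleton⁻)
open import Data.List.Relation.Unary.Unique.Propositional using (Unique)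
open import Data.Product using (_×_; _,_; proj₁; ∃-syntax)
open import Data.Sum using (inj₁; inj₂)
open import Relation.Nullary using (yes; no)
open import Relation.Binary.PropositionalEquality using (_≡_; refl; subst)

private
  variable
    Γ : Ctx
    M : Term
    α φ : Form
    T : List Form

-- Trace is defined by with-abstraction, so α and φ cannot be inferred from a
-- membership proof and are passed explicitly.
∈-Trace⁻ : ∀ α φ → T ∈ Trace α φ → α ∈ TG φ × T ∈ Trace' α φ
∈-Trace⁻ α φ t with any? (α ≟F_) (TG φ)
∈-Trace⁻ _ _ () | no _
... | yes α∈TG = α∈TG , t

∈-Trace⇒≡ : ∀ α φ → T ∈ Trace α φ → TG φ ≡ [ φ ] → α ≡ φ
∈-Trace⇒≡ α φ t TGφ≡[φ] = singleton⁻ (subst (α ∈_) TGφ≡[φ] (proj₁ (∈-Trace⁻ α φ t)))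

trace-elims : Γ ⊢ M ∶ φ → T ∈ Trace α φ → (∀ ρ → ρ ∈ T → Γ ⊢ ρ)
            → ∃[ Es ] (Γ ⊢ M · Es ∶ α)
trace-elims {φ = var p} {α = α} ⊢M t _ with refl ← ∈-Trace⇒≡ α (var p) t refl = [] , ⊢M
trace-elims {φ = ⊥'} {α = α} ⊢M t _ with refl ← ∈-Trace⇒≡ α ⊥' t refl = [] , ⊢M
trace-elims {φ = τ ∨ σ} {α = α} ⊢M t _ with refl ← ∈-Trace⇒≡ α (τ ∨ σ) t refl = [] , ⊢M
trace-elims {φ = τ ⇒ σ} {α = α} ⊢M t ⊢T
  with _ , t′ ← ∈-Trace⁻ α (τ ⇒ σ) t
  with T′ , t″ , refl ← ∈-map⁻ (τ ∷_) t′
  with N , ⊢N ← ⊢T τ (here refl)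
  with Es , ⊢MNEs ← trace-elims (⇒E ⊢M ⊢N) t″ (λ ρ ρ∈T′ → ⊢T ρ (there ρ∈T′))
  = arg N ∷ Es , ⊢MNEs
trace-elims {φ = τ ∧ σ} {α = α} ⊢M t ⊢T with _ , t′ ← ∈-Trace⁻ α (τ ∧ σ) t
  with ∈-++⁻ (Trace α τ) t′
... | inj₁ t₁ with Es , ⊢Mπ₁Es ← trace-elims (∧E₁ ⊢M) t₁ ⊢T = π₁ ∷ Es , ⊢Mπ₁Es
... | inj₂ t₂ with Es , ⊢Mπ₂Es ← trace-elims (∧E₂ ⊢M) t₂ ⊢T = π₂ ∷ Es , ⊢Mπ₂Es

lemma3p1 : (Γ : Ctx) → Unique (dom Γ) → (x : ℕ) (ψ α : Form) → (x , ψ) ∈ Γ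
    → AtomOrDisj α → (T : List Form) → T ∈ Trace α ψ
    → (∀ ρ → ρ ∈ T → Γ ⊢ ρ)
    → ∃[ Es ] (Γ ⊢ v x · Es ∶ α)
lemma3p1 Γ _ x ψ α x∶ψ∈Γ _ T t ⊢T = trace-elims (ax x∶ψ∈Γ) t ⊢T
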